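{- Let $n\ge1$ and let $F:\{0,1\}^n\to\{0,1\}^n$ be a centralized bijection and $C$ a Hamiltonian cycle of its interaction graph $G(F)$. Then $\sigma^C$ is a $w(F,C)$-swap of $F$.
   Context: Local functions: $f_j(x)=F(x)_j$. The interaction graph $G(F)$ on $V=\{1,\dots,n\}$ has an arc $(i,j)$ iff $f_j$ effectively depends on $x_i$ (there exist $x,x'$ differing only at $i$ with $f_j(x)\neq f_j(x')$). $F$ is centralized if $G(F)$ has a node whose deletion leaves the graph acyclic. For a Hamiltonian cycle $C$ of $G(F)$ and $i\in V$, let $j$ be the in-neighbor of $i$ on $C$; $w_i(F,C)$ is the number of $x\in\{0,1\}^n$ with $x_j<f_i(x)$, and $w(F,C)=\sum_{i=1}^n w_i(F,C)$. The map $\sigma^C$ is defined by $\sigma^C(x)_i=x_j$ where $j$ is the in-neighbor of $i$ on $C$. For distinct $x,y$, $(x\leftrightarrow y)$ is the permutation of $\{0,1\}^n$ exchanging $x$ and $y$ and fixing everything else. For $k\ge 1$, $F'$ is a $k$-swap of $F$ if there are configurations $x^1,y^1,\dots,x^k,y^k$ with $x^i\neq y^i$ for all $i$ such that $F'=F\circ(x^1\leftrightarrow y^1)\circ\cdots\circ(x^k\leftrightarrow y^k)$; the $0$-swap of $F$ is $F$ itself. -}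

module Defs where

open import Data.Bool using (Bool; true; false; not; _∧_; if_then_else_)
open import Data.Bool.Properties using () renaming (_≟_ to _≟ᵇ_)
open import Data.Nat using (ℕ; zero; suc; _+_)
open import Data.Fin using (Fin)
open import Data.Vec using (Vec; []; _∷_; lookup; tabulate; _[_]%=_)
open import Data.Vec.Properties using (≡-dec)
open import Data.List using (List; []; _∷_; map; _++_; length; filterᵇ; allFin)
open import Data.Nat.ListAction using (sum)
open import Data.Product using (Σ; ∃; _×_; _,_; proj₁; proj₂)
open import Relation.Nullary using (¬_; does)
open import Relation.Binary.PropositionalEquality using (_≡_; _≢_)

-- Configurations {0,1}^n (0 = false, 1 = true)
Config : ℕ → Set
Config n = Vec Bool n

loc : ∀ {n} → (Config n → Config n) → Fin n → Config n → Bool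
loc F j x = lookup (F x) j

flip : ∀ {n} → Config n → Fin n → Config n
flip x i = x [ i ]%= not

Arc : ∀ {n} → (Config n → Config n) → Fin n → Fin n → Set
Arc F i j = ∃ λ x → loc F j x ≢ loc F j (flip x i)

data Walk {n : ℕ} (A : Fin n → Fin n → Set) : Fin n → Fin n → Set where
  arc  : ∀ {i j} → A i j → Walk A i j
  _∷ʷ_ : ∀ {i j k} → A i j → Walk A j k → Walk A i k

Acyclic : ∀ {n} → (Fin n → Fin n → Set) → Set
Acyclic {n} A = (i : Fin n) → ¬ Walk A i i

ArcWithout : ∀ {n} → (Config n → Config n) → Fin n → Fin n → Fin n → Set
ArcWithout F v i j = Arc F i j × i ≢ v × j ≢ v

Centralized : ∀ {n} → (Config n → Config n) → Set
Centralized {n} F = Σ (Fin n) λ v → Acyclic (ArcWithout F v)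

iter : ∀ {A : Set} → (A → A) → ℕ → A → A
iter f zero    a = a
iter f (suc k) a = f (iter f k a)

-- A Hamiltonian cycle C of G(F), given by its in-neighbour map
-- pred : i ↦ (in-neighbour of i on C).  Every (pred i , i) is an arc of
-- G(F), and pred is a single cycle through all vertices.
record HamCycle {n : ℕ} (F : Config n → Config n) : Set where
  field
    pred      : Fin n → Fin n
    arcs      : (i : Fin n) → Arc F (pred i) i
    oneCycle  : (i j : Fin n) → ∃ λ k → iter pred k i ≡ j
open HamCycle public

allConfigs : (n : ℕ) → List (Config n)
allConfigs zero    = [] ∷ []
allConfigs (suc n) = map (false ∷_) (allConfigs n) ++ map (true ∷_) (allConfigs n)

_<ᵇ_ : Bool → Bool → Bool
a <ᵇ b = not a ∧ b

wᵢ : ∀ {n} (F : Config n → Config n) → HamCycle F → Fin n → ℕ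
wᵢ {n} F C i = length (filterᵇ (λ x → lookup x (pred C i) <ᵇ loc F i x) (allConfigs n))

w : ∀ {n} (F : Config n → Config n) → HamCycle F → ℕ
w {n} F C = sum (map (wᵢ F C) (allFin n))

σ : ∀ {n} {F : Config n → Config n} → HamCycle F → Config n → Config n
σ C x = tabulate (λ i → lookup x (pred C i))

swap : ∀ {n} → Config n → Config n → Config n → Config n
swap x y z with does (≡-dec _≟ᵇ_ z x)
... | true  = y
... | false = if does (≡-dec _≟ᵇ_ z y) then x else z

swaps : ∀ {n} → List (Config n × Config n) → Config n → Config n
swaps []             z = z
swaps ((x , y) ∷ ps) z = swap x y (swaps ps z)

data AllDistinct {n : ℕ} : List (Config n × Config n) → Set where
  []  : AllDistinct []
  _∷_ : ∀ {x y ps} → x ≢ y → AllDistinct ps → AllDistinct ((x , y) ∷ ps)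

-- F' is a k-swap of F (for k = 0 this forces F' = F pointwise)
IsSwap : ∀ {n} → ℕ → (Config n → Config n) → (Config n → Config n) → Set
IsSwap {n} k F' F = Σ (List (Config n × Config n)) λ ps →
  length ps ≡ k × AllDistinct ps × ((z : Config n) → F' z ≡ F (swaps ps z))

-- Let v be a centre and walk the cycle C backwards from it: orbit 0 = v, orbit (t + 1) = the
-- in-neighbour of orbit t.  Replacing, one at a time, the local function at orbit t by the
-- coordinate x_(orbit (t + 1)) turns F into σ^C through maps hybrid 0 = F, …, hybrid n = σ^C.
-- Inductively hybrid t is F composed with transpositions, so it is injective.  Because G(F) - v is
-- acyclic, hybrid t reads x_(orbit (t + 1)) only through its coordinate at orbit t; injectivity
-- then forces that local function to negate when x_(orbit (t + 1)) is flipped.  Hence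
-- hybrid (t + 1) = hybrid t ∘ π_t, with π_t the product of the disjoint transpositions
-- x ↔ flip x (orbit (t + 1)) over the w_(orbit t)(F,C) configurations x with x_(orbit (t + 1)) below
-- the local function.  The orbit visits every vertex once, so there are w(F,C) transpositions in all.

module Submission where

open import Defs
open import Data.Bool using (Bool; true; false; not; T; T?; _∧_)
open import Data.Bool.Properties using (not-involutive; not-¬; ¬-not; ∧-inverseˡ; ∧-comm)
  renaming (_≟_ to _≟ᵇ_)
open import Data.Fin using (Fin; toℕ; fromℕ<) renaming (_≟_ to _≟ᶠ_)
open import Data.Fin.Properties using (pigeonhole; toℕ-fromℕ<; toℕ<n; nonZeroIndex)
  renaming (<⇒≢ to <⇒≢ᶠ)
open import Data.List using (List; []; _∷_; map; _++_; _∷ʳ_; length; filterᵇ; allFin; applyUpTo)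
open import Data.List.Properties using (length-++; length-map; map-applyUpTo; applyUpTo-∷ʳ)
open import Data.List.Membership.Propositional using (_∈_; _∉_)
open import Data.List.Membership.Propositional.Properties
  using (∈-map⁺; ∈-map⁻; ∈-++⁺ˡ; ∈-++⁺ʳ; ∈-filter⁺; ∈-filter⁻; ∈-allFin; ∈-applyUpTo⁺)
open import Data.List.Membership.Propositional.Properties.WithK using (unique∧set⇒bag)
open import Data.List.Relation.Binary.BagAndSetEquality using (∼bag⇒↭)
open import Data.List.Relation.Binary.Permutation.Propositional using (_↭_)
import Data.List.Relation.Binary.Permutation.Propositional.Properties as ↭
open import Data.List.Relation.Unary.All as All using (All; []; _∷_)
open import Data.List.Relation.Unary.All.Properties using (All¬⇒¬Any; all-filter)
open import Data.List.Relation.Unary.Any using (here; there)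
open import Data.List.Relation.Unary.AllPairs using ([]; _∷_)
open import Data.List.Relation.Unary.Unique.Propositional using (Unique)
import Data.List.Relation.Unary.Unique.Propositional.Properties as Unique
open import Data.Nat
  using (ℕ; zero; suc; _+_; _*_; _∸_; _≤_; _<_; s≤s; s≤s⁻¹; z<s; NonZero; _%_; _/_; _<?_)
open import Data.Nat.DivMod using (m≡m%n+[m/n]*n; m%n<n)
open import Data.Nat.ListAction using (sum)
open import Data.Nat.ListAction.Properties using (sum-++; sum-↭)
open import Data.Nat.Properties
  using (≤-refl; ≤-trans; ≤-antisym; <-trans; ≤-<-trans; <⇒≤; n<1+n; <-cmp; ≮⇒≥; +-identityʳ;
         m∸n≤m; m<n⇒0<n∸m; m∸n+n≡m; m∸[m∸n]≡n; n∸n≡0; m≤n⇒m<n∨m≡n; ≤∧≢⇒<)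
open import Data.Product using (∃; _×_; _,_; proj₁; proj₂)
open import Data.Sum using (_⊎_; inj₁; inj₂; [_,_])
open import Data.Vec using ([]; _∷_; lookup; _[_]≔_)
open import Data.Vec.Properties
  using (≡-dec; ∷-injectiveʳ; lookup∘updateAt; lookup∘updateAt′; updateAt-updateAt;
  updateAt-cong; updateAt-id; lookup∘update; lookup∘update′; lookup∘tabulate)
open import Data.Vec.Relation.Binary.Pointwise.Extensional using (ext; Pointwise-≡⇒≡)
open import Function using (_∘_; mk⇔)
open import Function.Definitions using (Bijective; Injective)
open import Relation.Binary using (tri<; tri≈; tri>)
open import Relation.Nullary using (¬_; yes; no; contradiction)
open import Relation.Binary.PropositionalEquality
  using (_≡_; _≢_; refl; sym; trans; cong; cong₂; subst; module ≡-Reasoning)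

private
  variable
    A : Set
    n : ℕ

lookup-flip : (x : Config n) (j : Fin n) → lookup (flip x j) j ≡ not (lookup x j)
lookup-flip x j = lookup∘updateAt j x

lookup-flip′ : (x : Config n) {i j : Fin n} → i ≢ j → lookup (flip x j) i ≡ lookup x i
lookup-flip′ x {i} {j} i≢j = lookup∘updateAt′ i j i≢j x

flip-involutive : (x : Config n) (j : Fin n) → flip (flip x j) j ≡ x
flip-involutive x j =
  trans (updateAt-updateAt j x) (trans (updateAt-cong j not-involutive x) (updateAt-id j x))

flip-≢ : (x : Config n) (j : Fin n) → flip x j ≢ x
flip-≢ x j eq = not-¬ refl (trans (sym (cong (λ y → lookup y j) eq)) (lookup-flip x j))

swap-≡ˡ : (x y : Config n) → swap x y x ≡ y
swap-≡ˡ x y with ≡-dec _≟ᵇ_ x x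
... | yes _   = refl
... | no x≢x = contradiction refl x≢x

swap-≡ʳ : (x y : Config n) → swap x y y ≡ x
swap-≡ʳ x y with ≡-dec _≟ᵇ_ y x
... | yes y≡x = y≡x
... | no _ with ≡-dec _≟ᵇ_ y y
...   | yes _   = refl
...   | no y≢y = contradiction refl y≢y

swap-≢ : (x y : Config n) {z : Config n} → z ≢ x → z ≢ y → swap x y z ≡ z
swap-≢ x y {z} z≢x z≢y with ≡-dec _≟ᵇ_ z x
... | yes z≡x = contradiction z≡x z≢x
... | no _ with ≡-dec _≟ᵇ_ z y
...   | yes z≡y = contradiction z≡y z≢y
...   | no _    = refl

swap-involutive : (x y z : Config n) → swap x y (swap x y z) ≡ z
swap-involutive x y z with ≡-dec _≟ᵇ_ z x
... | yes z≡x = trans (swap-≡ʳ x y) (sym z≡x)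
... | no z≢x with ≡-dec _≟ᵇ_ z y
...   | yes z≡y = trans (swap-≡ˡ x y) (sym z≡y)
...   | no z≢y  = swap-≢ x y z≢x z≢y

swaps-injective : (ps : List (Config n × Config n)) → Injective _≡_ _≡_ (swaps ps)
swaps-injective []             eq = eq
swaps-injective ((x , y) ∷ ps) {a} {b} eq = swaps-injective ps (begin
  swaps ps a                             ≡⟨ swap-involutive x y _ ⟨
  swap x y (swap x y (swaps ps a))       ≡⟨ cong (swap x y) eq ⟩
  swap x y (swap x y (swaps ps b))       ≡⟨ swap-involutive x y _ ⟩
  swaps ps b                             ∎)
  where open ≡-Reasoning

swaps-++ : (ps qs : List (Config n × Config n)) (z : Config n) →
           swaps (ps ++ qs) z ≡ swaps ps (swaps qs z)
swaps-++ []             qs z = refl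
swaps-++ ((x , y) ∷ ps) qs z = cong (swap x y) (swaps-++ ps qs z)

AllDistinct-++ : {ps qs : List (Config n × Config n)} →
                 AllDistinct ps → AllDistinct qs → AllDistinct (ps ++ qs)
AllDistinct-++ []         qs = qs
AllDistinct-++ (x≢y ∷ ps) qs = x≢y ∷ AllDistinct-++ ps qs

endpoints : List (A × A) → List A
endpoints []             = []
endpoints ((x , y) ∷ ps) = x ∷ y ∷ endpoints ps

∈-endpointsˡ : {ps : List (A × A)} {x y : A} → (x , y) ∈ ps → x ∈ endpoints ps
∈-endpointsˡ          (here refl) = here refl
∈-endpointsˡ {ps = _ ∷ _} (there m) = there (there (∈-endpointsˡ m))

∈-endpointsʳ : {ps : List (A × A)} {x y : A} → (x , y) ∈ ps → y ∈ endpoints ps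
∈-endpointsʳ          (here refl) = there (here refl)
∈-endpointsʳ {ps = _ ∷ _} (there m) = there (there (∈-endpointsʳ m))

swaps-∉ : {ps : List (Config n × Config n)} {z : Config n} → z ∉ endpoints ps → swaps ps z ≡ z
swaps-∉ {ps = []}           z∉ = refl
swaps-∉ {ps = (x , y) ∷ ps} z∉ =
  trans (cong (swap x y) (swaps-∉ (z∉ ∘ there ∘ there)))
        (swap-≢ x y (z∉ ∘ here) (z∉ ∘ there ∘ here))

swaps-∈ˡ : {ps : List (Config n × Config n)} {z y : Config n} →
           Unique (endpoints ps) → (z , y) ∈ ps → swaps ps z ≡ y
swaps-∈ˡ {ps = (a , b) ∷ ps} (a∉ ∷ _ ∷ _) (here refl) =
  trans (cong (swap a b) (swaps-∉ (All¬⇒¬Any (All.tail a∉)))) (swap-≡ˡ a b)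
swaps-∈ˡ {ps = (a , b) ∷ ps} (a∉ ∷ b∉ ∷ u) (there m) =
  trans (cong (swap a b) (swaps-∈ˡ u m))
        (swap-≢ a b (All.lookup (All.tail a∉) (∈-endpointsʳ m) ∘ sym)
                    (All.lookup b∉ (∈-endpointsʳ m) ∘ sym))

swaps-∈ʳ : {ps : List (Config n × Config n)} {y z : Config n} →
           Unique (endpoints ps) → (y , z) ∈ ps → swaps ps z ≡ y
swaps-∈ʳ {ps = (a , b) ∷ ps} (_ ∷ b∉ ∷ _) (here refl) =
  trans (cong (swap a b) (swaps-∉ (All¬⇒¬Any b∉))) (swap-≡ʳ a b)
swaps-∈ʳ {ps = (a , b) ∷ ps} (a∉ ∷ b∉ ∷ u) (there m) =
  trans (cong (swap a b) (swaps-∈ʳ u m))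
        (swap-≢ a b (All.lookup (All.tail a∉) (∈-endpointsˡ m) ∘ sym)
                    (All.lookup b∉ (∈-endpointsˡ m) ∘ sym))

allConfigs-complete : (x : Config n) → x ∈ allConfigs n
allConfigs-complete         []          = here refl
allConfigs-complete {suc n} (false ∷ x) = ∈-++⁺ˡ (∈-map⁺ (false ∷_) (allConfigs-complete x))
allConfigs-complete {suc n} (true ∷ x)  =
  ∈-++⁺ʳ (map (false ∷_) (allConfigs n)) (∈-map⁺ (true ∷_) (allConfigs-complete x))

allConfigs-unique : (n : ℕ) → Unique (allConfigs n)
allConfigs-unique zero    = [] ∷ []
allConfigs-unique (suc n) =
  Unique.++⁺ (Unique.map⁺ ∷-injectiveʳ (allConfigs-unique n))
             (Unique.map⁺ ∷-injectiveʳ (allConfigs-unique n)) heads-differ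
  where
  heads-differ : ∀ {z} → ¬ (z ∈ map (false ∷_) (allConfigs n) × z ∈ map (true ∷_) (allConfigs n))
  heads-differ (m₀ , m₁) with ∈-map⁻ (false ∷_) m₀ | ∈-map⁻ (true ∷_) m₁
  ... | _ , _ , refl | _ , _ , ()

flipPairs : Fin n → List (Config n) → List (Config n × Config n)
flipPairs j = map (λ x → x , flip x j)

∈-endpoints-flipPairs : (j : Fin n) {L : List (Config n)} {z : Config n} →
                        z ∈ endpoints (flipPairs j L) → z ∈ L ⊎ flip z j ∈ L
∈-endpoints-flipPairs j {_ ∷ _} (here refl)         = inj₁ (here refl)
∈-endpoints-flipPairs j {x ∷ _} (there (here refl)) = inj₂ (here (flip-involutive x j))
∈-endpoints-flipPairs j {_ ∷ _} (there (there m))   =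
  [ inj₁ ∘ there , inj₂ ∘ there ] (∈-endpoints-flipPairs j m)

-- Distinctness comes from the j-th bit: 0 on L, 1 on its flips.
flipPairs-unique : (j : Fin n) {L : List (Config n)} → Unique L →
                   All (λ x → lookup x j ≡ false) L → Unique (endpoints (flipPairs j L))
flipPairs-unique j {[]}    _          _           = []
flipPairs-unique j {x ∷ L} (x∉L ∷ uL) (x₀ ∷ L₀) =
  All.tabulate x≢ ∷ All.tabulate flipx≢ ∷ flipPairs-unique j uL L₀
  where
  bits-differ : ∀ {y z} → lookup y j ≡ false → lookup z j ≡ true → y ≢ z
  bits-differ y₀ z₁ refl with () ← trans (sym y₀) z₁
  flip₁ : ∀ y → lookup y j ≡ false → lookup (flip y j) j ≡ true
  flip₁ y y₀ = trans (lookup-flip y j) (cong not y₀)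
  flip₀ : ∀ y → lookup (flip y j) j ≡ false → lookup y j ≡ true
  flip₀ y y₀ = subst (λ u → lookup u j ≡ true) (flip-involutive y j) (flip₁ (flip y j) y₀)
  x≢ : ∀ {z} → z ∈ flip x j ∷ endpoints (flipPairs j L) → x ≢ z
  x≢ (here refl) = flip-≢ x j ∘ sym
  x≢ {z} (there m) with ∈-endpoints-flipPairs j m
  ... | inj₁ z∈L  = All.lookup x∉L z∈L
  ... | inj₂ z′∈L = bits-differ x₀ (flip₀ z (All.lookup L₀ z′∈L))
  flipx≢ : ∀ {z} → z ∈ endpoints (flipPairs j L) → flip x j ≢ z
  flipx≢ m with ∈-endpoints-flipPairs j m
  ... | inj₁ z∈L  = λ eq → bits-differ (All.lookup L₀ z∈L) (flip₁ x x₀) (sym eq)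
  ... | inj₂ z′∈L = λ { refl → All.lookup x∉L z′∈L (sym (flip-involutive x j)) }

flipPairs-distinct : (j : Fin n) (L : List (Config n)) → AllDistinct (flipPairs j L)
flipPairs-distinct j []      = []
flipPairs-distinct j (x ∷ L) = (flip-≢ x j ∘ sym) ∷ flipPairs-distinct j L

<ᵇ-irrefl : {b c : Bool} → b ≡ c → b <ᵇ c ≡ false
<ᵇ-irrefl {b} refl = ∧-inverseˡ b

<ᵇ⇒≡false : {b c : Bool} → T (b <ᵇ c) → b ≡ false
<ᵇ⇒≡false {false} _ = refl

<ᵇ-connex : {b c : Bool} → b ≢ c → T (b <ᵇ c) ⊎ T (c <ᵇ b)
<ᵇ-connex {false} {false} b≢c = contradiction refl b≢c
<ᵇ-connex {false} {true}  _   = inj₁ _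
<ᵇ-connex {true}  {false} _   = inj₂ _
<ᵇ-connex {true}  {true}  b≢c = contradiction refl b≢c

rises : Fin n → (Config n → Bool) → Config n → Bool
rises j f x = lookup x j <ᵇ f x

-- For j the in-neighbour of i and f = f_i this list has w_i(F,C) pairs.
risePairs : Fin n → (Config n → Bool) → List (Config n × Config n)
risePairs {n} j f = flipPairs j (filterᵇ (rises j f) (allConfigs n))

risePairs-unique : (j : Fin n) (f : Config n → Bool) → Unique (endpoints (risePairs j f))
risePairs-unique {n} j f =
  flipPairs-unique j (Unique.filter⁺ (T? ∘ rises j f) (allConfigs-unique n))
                     (All.map <ᵇ⇒≡false (all-filter (T? ∘ rises j f) (allConfigs n)))

∈-risePairs : {j : Fin n} {f : Config n → Bool} {z : Config n} →
              T (rises j f z) → (z , flip z j) ∈ risePairs j f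
∈-risePairs {j = j} {f} {z} r =
  ∈-map⁺ (λ x → x , flip x j) (∈-filter⁺ (T? ∘ rises j f) (allConfigs-complete z) r)

∉-risePairs : {j : Fin n} {f : Config n → Bool} {z : Config n} →
              rises j f z ≡ false → rises j f (flip z j) ≡ false → swaps (risePairs j f) z ≡ z
∉-risePairs {n} {j} {f} {z} r r′ =
  swaps-∉ (λ m → [ no-rise r , no-rise r′ ] (∈-endpoints-flipPairs j m))
  where
  no-rise : ∀ {y} → rises j f y ≡ false → y ∉ filterᵇ (rises j f) (allConfigs n)
  no-rise r m = subst T r (proj₂ (∈-filter⁻ (T? ∘ rises j f) {xs = allConfigs n} m))

module _ {n : ℕ} {j : Fin n} {f : Config n → Bool} (f-flips : ∀ x → f (flip x j) ≡ not (f x)) where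

  rises-flip : ∀ z → rises j f (flip z j) ≡ f z <ᵇ lookup z j
  rises-flip z = begin
    not (lookup (flip z j) j) ∧ f (flip z j)
      ≡⟨ cong₂ (λ a b → not a ∧ b) (lookup-flip z j) (f-flips z) ⟩
    not (not (lookup z j)) ∧ not (f z)       ≡⟨ cong (_∧ not (f z)) (not-involutive _) ⟩
    lookup z j ∧ not (f z)                   ≡⟨ ∧-comm (lookup z j) (not (f z)) ⟩
    not (f z) ∧ lookup z j                   ∎
    where open ≡-Reasoning

  swaps-risePairs-≡ : ∀ z → lookup z j ≡ f z → swaps (risePairs j f) z ≡ z
  swaps-risePairs-≡ z agree =
    ∉-risePairs (<ᵇ-irrefl agree) (trans (rises-flip z) (<ᵇ-irrefl (sym agree)))

  swaps-risePairs-≢ : ∀ z → lookup z j ≢ f z → swaps (risePairs j f) z ≡ flip z j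
  swaps-risePairs-≢ z disagree with <ᵇ-connex disagree
  ... | inj₁ r = swaps-∈ˡ (risePairs-unique j f) (∈-risePairs r)
  ... | inj₂ r = swaps-∈ʳ (risePairs-unique j f)
                   (subst (λ u → (flip z j , u) ∈ risePairs j f) (flip-involutive z j)
                          (∈-risePairs (subst T (sym (rises-flip z)) r)))

iter-+ : (f : A → A) (k m : ℕ) (x : A) → iter f (k + m) x ≡ iter f k (iter f m x)
iter-+ f zero    m x = refl
iter-+ f (suc k) m x = cong f (iter-+ f k m x)

iter-*-fixed : (f : A → A) {k : ℕ} {x : A} → iter f k x ≡ x → ∀ q → iter f (q * k) x ≡ x
iter-*-fixed f         p zero    = refl
iter-*-fixed f {k} {x} p (suc q) = begin
  iter f (k + q * k) x          ≡⟨ iter-+ f k (q * k) x ⟩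
  iter f k (iter f (q * k) x)   ≡⟨ cong (iter f k) (iter-*-fixed f p q) ⟩
  iter f k x                    ≡⟨ p ⟩
  x                             ∎
  where open ≡-Reasoning

iter-% : (f : A → A) {k : ℕ} .{{_ : NonZero k}} {x : A} → iter f k x ≡ x →
         ∀ m → iter f m x ≡ iter f (m % k) x
iter-% f {k} {x} p m = begin
  iter f m x                              ≡⟨ cong (λ r → iter f r x) (m≡m%n+[m/n]*n m k) ⟩
  iter f (m % k + m / k * k) x            ≡⟨ iter-+ f (m % k) (m / k * k) x ⟩
  iter f (m % k) (iter f (m / k * k) x)   ≡⟨ cong (iter f (m % k)) (iter-*-fixed f p (m / k)) ⟩
  iter f (m % k) x                        ∎
  where open ≡-Reasoning

module Orbit {n : ℕ} (P : Fin n → Fin n) (reach : ∀ i j → ∃ λ k → iter P k i ≡ j) (v : Fin n) where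

  -- If P^k fixes i, every j is P^r i for some r < k; pigeonhole rules this out when k < n.
  no-short-cycle : ∀ {i k} → 0 < k → k < n → iter P k i ≢ i
  no-short-cycle {i} {suc k} _ k<n fixed =
    let j₁ , j₂ , j₁<j₂ , same = pigeonhole k<n residue in <⇒≢ᶠ j₁<j₂ (residue-injective same)
    where
    steps : Fin n → ℕ
    steps j = proj₁ (reach i j)
    residue : Fin n → Fin (suc k)
    residue j = fromℕ< (m%n<n (steps j) (suc k))
    lands : ∀ j → iter P (toℕ (residue j)) i ≡ j
    lands j = begin
      iter P (toℕ (residue j)) i
        ≡⟨ cong (λ r → iter P r i) (toℕ-fromℕ< (m%n<n (steps j) (suc k))) ⟩
      iter P (steps j % suc k) i    ≡⟨ iter-% P fixed (steps j) ⟨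
      iter P (steps j) i            ≡⟨ proj₂ (reach i j) ⟩
      j                             ∎
      where open ≡-Reasoning
    residue-injective : ∀ {j₁ j₂} → residue j₁ ≡ residue j₂ → j₁ ≡ j₂
    residue-injective {j₁} {j₂} same =
      trans (sym (lands j₁)) (trans (cong (λ r → iter P (toℕ r) i) same) (lands j₂))

  orbit : ℕ → Fin n
  orbit t = iter P t v

  orbit-injective : ∀ {p q} → p < q → q ∸ p < n → orbit p ≢ orbit q
  orbit-injective {p} {q} p<q gap eq = no-short-cycle (m<n⇒0<n∸m p<q) gap (begin
    iter P (q ∸ p) (orbit p)    ≡⟨ iter-+ P (q ∸ p) p v ⟨
    orbit (q ∸ p + p)           ≡⟨ cong orbit (m∸n+n≡m (<⇒≤ p<q)) ⟩
    orbit q                     ≡⟨ eq ⟨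
    orbit p                     ∎)
    where open ≡-Reasoning

  -- By pigeonhole two of orbit 0, …, orbit n coincide; injectivity forces them to be the ends.
  orbit-returns : orbit n ≡ v
  orbit-returns with i , j , i<j , same ← pigeonhole (n<1+n n) (orbit ∘ toℕ)
                   | (toℕ j ∸ toℕ i) <? n
  ... | yes gap = contradiction same (orbit-injective i<j gap)
  ... | no ¬gap = begin
    orbit n                       ≡⟨ cong orbit j≡n ⟨
    orbit (toℕ j)                 ≡⟨ same ⟨
    orbit (toℕ i)                 ≡⟨ cong orbit i≡0 ⟩
    v                             ∎
    where
    open ≡-Reasoning
    j≤n : toℕ j ≤ n
    j≤n = s≤s⁻¹ (toℕ<n j)
    n≤gap : n ≤ toℕ j ∸ toℕ i
    n≤gap = ≮⇒≥ ¬gap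
    j≡n : toℕ j ≡ n
    j≡n = ≤-antisym j≤n (≤-trans n≤gap (m∸n≤m (toℕ j) (toℕ i)))
    gap≡j : toℕ j ∸ toℕ i ≡ toℕ j
    gap≡j = ≤-antisym (m∸n≤m (toℕ j) (toℕ i)) (subst (_≤ toℕ j ∸ toℕ i) (sym j≡n) n≤gap)
    i≡0 : toℕ i ≡ 0
    i≡0 = trans (sym (m∸[m∸n]≡n (<⇒≤ i<j))) (trans (cong (toℕ j ∸_) gap≡j) (n∸n≡0 (toℕ j)))

  orbit-covers : ∀ i → ∃ λ a → a < n × orbit a ≡ i
  orbit-covers i = k % n , m%n<n k n , trans (sym (iter-% P orbit-returns k)) (proj₂ (reach v i))
    where
    instance
      n≢0 : NonZero n
      n≢0 = nonZeroIndex v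
    k : ℕ
    k = proj₁ (reach v i)

  sum-orbit : (g : Fin n → ℕ) → sum (applyUpTo (g ∘ orbit) n) ≡ sum (map g (allFin n))
  sum-orbit g = begin
    sum (applyUpTo (g ∘ orbit) n)      ≡⟨ cong sum (map-applyUpTo orbit g n) ⟨
    sum (map g (applyUpTo orbit n))    ≡⟨ sum-↭ (↭.map⁺ g orbit↭allFin) ⟩
    sum (map g (allFin n))             ∎
    where
    open ≡-Reasoning
    unique : Unique (applyUpTo orbit n)
    unique = Unique.applyUpTo⁺₁ orbit n
               (λ {i} {j} i<j j<n → orbit-injective i<j (≤-<-trans (m∸n≤m j i) j<n))
    complete : ∀ i → i ∈ applyUpTo orbit n
    complete i with a , a<n , refl ← orbit-covers i = ∈-applyUpTo⁺ orbit a<n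
    orbit↭allFin : applyUpTo orbit n ↭ allFin n
    orbit↭allFin = ∼bag⇒↭ (unique∧set⇒bag unique (Unique.allFin⁺ n)
                                           (mk⇔ (λ _ → ∈-allFin _) (λ _ → complete _)))

-- Replacing the local functions one at a time

module Hybrid {n : ℕ} (F : Config n → Config n) (C : HamCycle F) (v : Fin n)
              (acyclic : Acyclic (ArcWithout F v)) where

  open Orbit (pred C) (oneCycle C) v public

  orbit-≢-centre : ∀ {s} → 0 < s → s < n → orbit s ≢ v
  orbit-≢-centre 0<s s<n eq = orbit-injective 0<s s<n (sym eq)

  cycle-arc : ∀ {s} → 0 < s → suc s < n → ArcWithout F v (orbit (suc s)) (orbit s)
  cycle-arc 0<s s+1<n =
    arcs C _ , orbit-≢-centre z<s s+1<n , orbit-≢-centre 0<s (<-trans (n<1+n _) s+1<n)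

  descend : ∀ {a b} → 0 < b → b ≤ a → a < n →
            ∀ {i} → ArcWithout F v i (orbit a) → Walk (ArcWithout F v) i (orbit b)
  descend 0<b b≤a a<n e with m≤n⇒m<n∨m≡n b≤a
  ... | inj₂ refl       = arc e
  ... | inj₁ (s≤s b≤a′) =
    e ∷ʷ descend 0<b b≤a′ (<-trans (n<1+n _) a<n) (cycle-arc (≤-trans 0<b b≤a′) a<n)

  -- An arc orbit b → orbit a would close a cycle through orbit (a - 1), …, orbit b, avoiding v.
  loc-ignores : ∀ {a b} → 0 < b → b ≤ a → a < n →
                ∀ x → loc F (orbit a) (flip x (orbit b)) ≡ loc F (orbit a) x
  loc-ignores {a} {b} 0<b b≤a a<n x with loc F (orbit a) x ≟ᵇ loc F (orbit a) (flip x (orbit b))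
  ... | yes same = sym same
  ... | no differ = contradiction (descend 0<b b≤a a<n arc-ba) (acyclic (orbit b))
    where
    arc-ba : ArcWithout F v (orbit b) (orbit a)
    arc-ba = (x , differ) ,
             orbit-≢-centre 0<b (≤-<-trans b≤a a<n) , orbit-≢-centre (≤-trans 0<b b≤a) a<n

  hybrid : ℕ → Config n → Config n
  hybrid zero    x = F x
  hybrid (suc t) x = hybrid t x [ orbit t ]≔ lookup x (orbit (suc t))

  lookup-hybrid-pending : ∀ {t a} → t ≤ a → a < n →
                          ∀ x → lookup (hybrid t x) (orbit a) ≡ loc F (orbit a) x
  lookup-hybrid-pending {zero}  _   _   x = refl
  lookup-hybrid-pending {suc t} {a} t<a a<n x =
    trans (lookup∘update′ (orbit-injective t<a (≤-<-trans (m∸n≤m a t) a<n) ∘ sym) (hybrid t x) _)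
          (lookup-hybrid-pending (<⇒≤ t<a) a<n x)

  lookup-hybrid-done : ∀ {s t} → s < t → ∀ x → lookup (hybrid t x) (orbit s) ≡ lookup x (orbit (suc s))
  lookup-hybrid-done {s} {suc t} s<t+1 x with orbit s ≟ᶠ orbit t
  ... | yes same = begin
    lookup (hybrid (suc t) x) (orbit s)   ≡⟨ cong (lookup (hybrid (suc t) x)) same ⟩
    lookup (hybrid (suc t) x) (orbit t)   ≡⟨ lookup∘update (orbit t) (hybrid t x) _ ⟩
    lookup x (pred C (orbit t))           ≡⟨ cong (lookup x ∘ pred C) same ⟨
    lookup x (pred C (orbit s))           ∎
    where open ≡-Reasoning
  ... | no differ = trans (lookup∘update′ differ (hybrid t x) _)
                          (lookup-hybrid-done (≤∧≢⇒< (s≤s⁻¹ s<t+1) (differ ∘ cong orbit)) x)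

  σ≗hybrid : ∀ z → σ C z ≡ hybrid n z
  σ≗hybrid z = Pointwise-≡⇒≡ (ext agree)
    where
    agree : ∀ i → lookup (σ C z) i ≡ lookup (hybrid n z) i
    agree i with a , a<n , refl ← orbit-covers i =
      trans (lookup∘tabulate (λ i → lookup z (pred C i)) (orbit a)) (sym (lookup-hybrid-done a<n z))

  hybrid-ignores : ∀ {t} → t < n → ∀ {i} → i ≢ orbit t →
                   ∀ x → lookup (hybrid t (flip x (orbit (suc t)))) i ≡ lookup (hybrid t x) i
  hybrid-ignores {t} t<n {i} i≢ x with a , a<n , refl ← orbit-covers i | <-cmp a t
  ... | tri< a<t _ _ = begin
    lookup (hybrid t (flip x (orbit (suc t)))) (orbit a)   ≡⟨ lookup-hybrid-done a<t _ ⟩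
    lookup (flip x (orbit (suc t))) (orbit (suc a))       ≡⟨ lookup-flip′ x differ ⟩
    lookup x (orbit (suc a))                              ≡⟨ lookup-hybrid-done a<t x ⟨
    lookup (hybrid t x) (orbit a)                         ∎
    where
    open ≡-Reasoning
    differ : orbit (suc a) ≢ orbit (suc t)
    differ = orbit-injective (s≤s a<t) (≤-<-trans (m∸n≤m t a) t<n)
  ... | tri≈ _ refl _ = contradiction refl i≢
  ... | tri> _ _ t<a = begin
    lookup (hybrid t (flip x (orbit (suc t)))) (orbit a)   ≡⟨ lookup-hybrid-pending (<⇒≤ t<a) a<n _ ⟩
    loc F (orbit a) (flip x (orbit (suc t)))              ≡⟨ loc-ignores z<s t<a a<n x ⟩
    loc F (orbit a) x                                     ≡⟨ lookup-hybrid-pending (<⇒≤ t<a) a<n x ⟨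
    lookup (hybrid t x) (orbit a)                         ∎
    where open ≡-Reasoning

  -- If f_(orbit t) ignored x_(orbit (t + 1)) at some x, hybrid t would identify x with its flip.
  loc-flips : ∀ {t} → t < n → Injective _≡_ _≡_ (hybrid t) →
              ∀ x → loc F (orbit t) (flip x (orbit (suc t))) ≡ not (loc F (orbit t) x)
  loc-flips {t} t<n injective x =
    ¬-not λ same → flip-≢ x j (injective (Pointwise-≡⇒≡ (ext (agree same))))
    where
    j : Fin n
    j = orbit (suc t)
    agree : loc F (orbit t) (flip x j) ≡ loc F (orbit t) x →
            ∀ i → lookup (hybrid t (flip x j)) i ≡ lookup (hybrid t x) i
    agree same i with i ≟ᶠ orbit t
    ... | yes refl = trans (lookup-hybrid-pending ≤-refl t<n _)
                           (trans same (sym (lookup-hybrid-pending ≤-refl t<n x)))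
    ... | no i≢ = hybrid-ignores t<n i≢ x

  hybrid-suc : ∀ {t} → t < n → ∀ z z′ →
               (∀ {i} → i ≢ orbit t → lookup (hybrid t z′) i ≡ lookup (hybrid t z) i) →
               loc F (orbit t) z′ ≡ lookup z (orbit (suc t)) → hybrid (suc t) z ≡ hybrid t z′
  hybrid-suc {t} t<n z z′ off-orbit-t at-orbit-t = Pointwise-≡⇒≡ (ext agree)
    where
    agree : ∀ i → lookup (hybrid (suc t) z) i ≡ lookup (hybrid t z′) i
    agree i with i ≟ᶠ orbit t
    ... | yes refl = trans (lookup∘update i (hybrid t z) _)
                           (trans (sym at-orbit-t) (sym (lookup-hybrid-pending ≤-refl t<n z′)))
    ... | no i≢ = trans (lookup∘update′ i≢ (hybrid t z) _) (sym (off-orbit-t i≢))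

  stepPairs : ℕ → List (Config n × Config n)
  stepPairs t = risePairs (orbit (suc t)) (loc F (orbit t))

  hybrid-step : ∀ {t} → t < n → Injective _≡_ _≡_ (hybrid t) →
                ∀ z → hybrid (suc t) z ≡ hybrid t (swaps (stepPairs t) z)
  hybrid-step {t} t<n injective z with lookup z (orbit (suc t)) ≟ᵇ loc F (orbit t) z
  ... | yes agree =
    trans (hybrid-suc t<n z z (λ _ → refl) (sym agree))
          (cong (hybrid t) (sym (swaps-risePairs-≡ (loc-flips t<n injective) z agree)))
  ... | no disagree =
    trans (hybrid-suc t<n z (flip z (orbit (suc t))) (λ i≢ → hybrid-ignores t<n i≢ z)
                      (trans (loc-flips t<n injective z) (sym (¬-not disagree))))
          (cong (hybrid t) (sym (swaps-risePairs-≢ (loc-flips t<n injective) z disagree)))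

  pairsUpTo : ℕ → List (Config n × Config n)
  pairsUpTo zero    = []
  pairsUpTo (suc t) = pairsUpTo t ++ stepPairs t

  hybrid≗swaps : Injective _≡_ _≡_ F →
                 ∀ {t} → t ≤ n → ∀ z → hybrid t z ≡ F (swaps (pairsUpTo t) z)
  hybrid≗swaps F-injective {zero}  _   z = refl
  hybrid≗swaps F-injective {suc t} t<n z = begin
    hybrid (suc t) z                                     ≡⟨ hybrid-step t<n injective z ⟩
    hybrid t (swaps (stepPairs t) z)                     ≡⟨ IH (swaps (stepPairs t) z) ⟩
    F (swaps (pairsUpTo t) (swaps (stepPairs t) z))      ≡⟨ cong F (swaps-++ (pairsUpTo t) (stepPairs t) z) ⟨
    F (swaps (pairsUpTo (suc t)) z)                      ∎
    where
    open ≡-Reasoning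
    IH : ∀ z → hybrid t z ≡ F (swaps (pairsUpTo t) z)
    IH = hybrid≗swaps F-injective (<⇒≤ t<n)
    injective : Injective _≡_ _≡_ (hybrid t)
    injective {x} {y} eq = swaps-injective (pairsUpTo t) (F-injective (trans (sym (IH x)) (trans eq (IH y))))

  pairsUpTo-distinct : ∀ t → AllDistinct (pairsUpTo t)
  pairsUpTo-distinct zero    = []
  pairsUpTo-distinct (suc t) = AllDistinct-++ (pairsUpTo-distinct t) (flipPairs-distinct _ _)

  length-stepPairs : ∀ t → length (stepPairs t) ≡ wᵢ F C (orbit t)
  length-stepPairs t = length-map _ (filterᵇ (rises (orbit (suc t)) (loc F (orbit t))) (allConfigs n))

  length-pairsUpTo : ∀ t → length (pairsUpTo t) ≡ sum (applyUpTo (wᵢ F C ∘ orbit) t)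
  length-pairsUpTo zero    = refl
  length-pairsUpTo (suc t) = begin
    length (pairsUpTo t ++ stepPairs t)           ≡⟨ length-++ (pairsUpTo t) ⟩
    length (pairsUpTo t) + length (stepPairs t)   ≡⟨ cong₂ _+_ (length-pairsUpTo t) (length-stepPairs t) ⟩
    sum (applyUpTo g t) + g t                     ≡⟨ cong (sum (applyUpTo g t) +_) (+-identityʳ (g t)) ⟨
    sum (applyUpTo g t) + sum (g t ∷ [])          ≡⟨ sum-++ (applyUpTo g t) (g t ∷ []) ⟨
    sum (applyUpTo g t ∷ʳ g t)                    ≡⟨ cong sum (applyUpTo-∷ʳ g t) ⟩
    sum (applyUpTo g (suc t))                     ∎
    where
    open ≡-Reasoning
    g : ℕ → ℕ
    g = wᵢ F C ∘ orbit

-- 1 ≤ n is implied by the existence of the centre v.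
lemma8 : (n : ℕ) → 1 ≤ n → (F : Config n → Config n) → Bijective _≡_ _≡_ F →
         Centralized F → (C : HamCycle F) → IsSwap (w F C) (σ C) F
lemma8 n _ F (F-injective , _) (v , acyclic) C =
  pairsUpTo n ,
  trans (length-pairsUpTo n) (sum-orbit (wᵢ F C)) ,
  pairsUpTo-distinct n ,
  λ z → trans (σ≗hybrid z) (hybrid≗swaps F-injective ≤-refl z)
  where open Hybrid F C v acyclic
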